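{- Let $n\ge 1$. Two independent walkers start at the origin and each takes $n$ steps, each step being N $(0,+1)$ or E $(+1,0)$ with probability $1/2$ each, independently. Conditioned on the two walkers finishing at the same point, the probability that the two paths have exactly $k$ common vertices other than the starting point $(0,0)$ and the common final point is $$p(n,k)=\frac{2^{k+1}(k+1)\,(2n-k-2)!\,n!}{(n-k-1)!\,(2n)!}\qquad(0\le k\le n-1),$$ and in particular $\sum_{k=0}^{n-1}p(n,k)=1$. -}

module Defs where

open import Data.Bool using (Bool; true; false)
open import Data.Nat using (ℕ; zero; suc; _+_; _*_; _∸_; _^_; _!)
import Data.Nat.Properties as ℕP
open import Data.Integer using (+_)
open import Data.Rational using (ℚ; _/_; 0ℚ)
open import Data.Product using (_×_; _,_)
open import Data.Product.Properties using (≡-dec)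
open import Data.List using (List; []; _∷_; map; length; filter; cartesianProduct; take; upTo; foldr)
open import Data.List.Membership.DecPropositional (≡-dec ℕP._≟_ ℕP._≟_) using (_∈_; _∈?_)
open import Data.Vec using (Vec; []; _∷_)
open import Relation.Binary.PropositionalEquality using (_≡_)
open import Relation.Nullary using (Dec; yes; no)
open import Relation.Unary using (Decidable)

Point : Set
Point = ℕ × ℕ

-- A path of n steps: true = N (0,+1), false = E (+1,0).
Path : ℕ → Set
Path n = Vec Bool n

-- All 2^n paths of length n (uniform distribution = counting).
allPaths : (n : ℕ) → List (Path n)
allPaths zero    = [] ∷ []
allPaths (suc n) = map (true ∷_) (allPaths n) Data.List.++ map (false ∷_) (allPaths n)

step : Point → Bool → Point
step (x , y) true  = (x , suc y)
step (x , y) false = (suc x , y)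

vertsFrom : ∀ {m} → Point → Vec Bool m → List Point
vertsFrom p []       = []
vertsFrom p (b ∷ bs) = step p b ∷ vertsFrom (step p b) bs

verts : ∀ {n} → Path n → List Point
verts ps = vertsFrom (0 , 0) ps

endFrom : ∀ {m} → Point → Vec Bool m → Point
endFrom p []       = p
endFrom p (b ∷ bs) = endFrom (step p b) bs

endpoint : ∀ {n} → Path n → Point
endpoint ps = endFrom (0 , 0) ps

-- Vertices other than the start (0,0) and the final point: steps 1..n-1.
interior : ∀ {n} → Path n → List Point
interior {n} ps = take (n ∸ 1) (verts ps)

-- Vertices along a N/E path are distinct, so counting the
-- interior vertices of the first path that lie on the interior of the second
-- counts common vertices.
commonInterior : ∀ {n} → Path n → Path n → ℕ
commonInterior p q = length (filter (_∈? interior q) (interior p))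

sameEnd? : ∀ {n} → Decidable (λ (pq : Path n × Path n) → endpoint (Data.Product.proj₁ pq) ≡ endpoint (Data.Product.proj₂ pq))
sameEnd? (p , q) = ≡-dec ℕP._≟_ ℕP._≟_ (endpoint p) (endpoint q)

sameEndPairs : (n : ℕ) → List (Path n × Path n)
sameEndPairs n = filter sameEnd? (cartesianProduct (allPaths n) (allPaths n))

countK : (n k : ℕ) → List (Path n × Path n)
countK n k = filter (λ pq → commonInterior (Data.Product.proj₁ pq) (Data.Product.proj₂ pq) ℕP.≟ k) (sameEndPairs n)

-- a / b as a rational (with the convention a / 0 = 0, never used below since
-- all denominators occurring are positive).
frac : ℕ → ℕ → ℚ
frac a zero    = 0ℚ
frac a (suc b) = (+ a) / suc b

condProb : (n k : ℕ) → ℚ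
condProb n k = frac (length (countK n k)) (length (sameEndPairs n))

pClosed : (n k : ℕ) → ℚ
pClosed n k = frac (2 ^ (k + 1) * (k + 1) * (2 * n ∸ k ∸ 2) ! * n !)
                   ((n ∸ k ∸ 1) ! * (2 * n) !)

sumBelow : ℕ → (ℕ → ℚ) → ℚ
sumBelow n f = foldr (λ k acc → f k Data.Rational.+ acc) 0ℚ (upTo n)

-- At step i both walkers lie on the antidiagonal x + y = i, so a vertex common to both
-- paths is visited by both at the same step: common interior vertices are meetings of
-- the pair.  The future of a pair depends only on the horizontal distance h between the
-- walkers, which a joint step changes by 0 (NN, EE) or by ±1 (NE, EN).  Hence the numbers
-- of m-step continuations that end together, resp. end together after exactly j meetings,
-- satisfy recurrences in m, solved by C(2m, m + h), resp. by 2^j times a ballot number.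
-- From the origin these are C(2n, n) and 2^(k+1) (k+1) (2n-k-2)! / ((n-k-1)! n!), whose
-- ratio is p(n,k); the values k < n partition the pairs with a common end.

module Submission where

open import Defs
open import Level using (Level)
open import Data.Bool using (Bool; true; false; if_then_else_)
open import Data.Nat using (ℕ; zero; suc; _+_; _*_; _∸_; _^_; _!; _⊓_; _≤_; _<_; z<s; s≤s)
open import Data.Nat.Properties
open import Data.Nat.Combinatorics
  using (_C_; nCk+nC[k+1]≡[n+1]C[k+1]; nCk≡nC[n∸k]; nCk≡n!/k![n-k]!; k![n∸k]!∣n!)
open import Data.Nat.DivMod using (_/_; m*[n/m]≡n)
open import Data.Nat.Tactic.RingSolver using (solve-∀)
open import Algebra.Properties.CommutativeSemigroup +-commutativeSemigroup using (interchange)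
import Data.Integer as ℤ
import Data.Integer.Properties as ℤ
import Data.Integer.Tactic.RingSolver as ℤ-Solver
open import Data.Rational as ℚ using (ℚ; 0ℚ; 1ℚ; toℚᵘ)
open import Data.Rational.Properties
  using (fromℚᵘ-cong; toℚᵘ-injective; toℚᵘ-homo-+; toℚᵘ-fromℚᵘ; 0/n≡0)
open import Data.Rational.Unnormalised as ℚᵘ using (ℚᵘ; mkℚᵘ; *≡*; _≃_)
import Data.Rational.Unnormalised.Properties as ℚᵘ
open import Data.Product using (_×_; _,_; proj₁; proj₂)
open import Data.Product.Properties using (≡-dec)
open import Data.List using (List; []; _∷_; _++_; map; length; filter; cartesianProduct; take; upTo; foldr)
import Data.List.Properties as List
open import Data.List.Membership.DecPropositional (≡-dec _≟_ _≟_) using (_∈_; _∈?_)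
open import Data.List.Relation.Unary.All using (All; []; _∷_)
open import Data.List.Relation.Unary.All.Properties using (applyUpTo⁺₁)
open import Data.List.Relation.Unary.Any using (here; there)
open import Data.Vec using (Vec; []; _∷_)
open import Data.Empty using (⊥-elim)
open import Function using (id; _⇔_; mk⇔)
open import Relation.Binary.PropositionalEquality
open import Relation.Binary.Definitions using (DecidableEquality)
open import Relation.Nullary using (Dec; does; yes; no)
open import Relation.Nullary.Decidable using (does-⇔)
open import Relation.Unary using (Pred; Decidable)

private variable
  ℓ ℓ′ : Level
  A B : Set ℓ

𝟙 : Dec A → ℕ
𝟙 A? = if does A? then 1 else 0

𝟙-⇔ : A ⇔ B → (A? : Dec A) (B? : Dec B) → 𝟙 A? ≡ 𝟙 B?
𝟙-⇔ A⇔B A? B? = cong (λ b → if b then 1 else 0) (does-⇔ A⇔B A? B?)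

∑ : List A → (A → ℕ) → ℕ
∑ []       f = 0
∑ (x ∷ xs) f = f x + ∑ xs f

infix 5 ∑
syntax ∑ xs (λ x → e) = ∑[ x ∈ xs ] e

∑-cong : ∀ (xs : List A) {f g : A → ℕ} → (∀ x → f x ≡ g x) → ∑ xs f ≡ ∑ xs g
∑-cong []       f≗g = refl
∑-cong (x ∷ xs) f≗g = cong₂ _+_ (f≗g x) (∑-cong xs f≗g)

∑-++ : ∀ (xs ys : List A) (f : A → ℕ) → ∑ (xs ++ ys) f ≡ ∑ xs f + ∑ ys f
∑-++ []       ys f = refl
∑-++ (x ∷ xs) ys f = trans (cong (f x +_) (∑-++ xs ys f)) (sym (+-assoc (f x) _ _))

∑-map : ∀ (g : A → B) xs (f : B → ℕ) → ∑ (map g xs) f ≡ ∑[ x ∈ xs ] f (g x)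
∑-map g []       f = refl
∑-map g (x ∷ xs) f = cong (f (g x) +_) (∑-map g xs f)

∑-zero : ∀ (xs : List A) → ∑[ x ∈ xs ] 0 ≡ 0
∑-zero []       = refl
∑-zero (x ∷ xs) = ∑-zero xs

∑-+ : ∀ (xs : List A) (f g : A → ℕ) → ∑[ x ∈ xs ] (f x + g x) ≡ ∑ xs f + ∑ xs g
∑-+ []       f g = refl
∑-+ (x ∷ xs) f g = trans (cong (f x + g x +_) (∑-+ xs f g)) (interchange (f x) (g x) _ _)

∑-comm : ∀ (xs : List A) (ys : List B) (f : A → B → ℕ) →
         ∑[ x ∈ xs ] ∑[ y ∈ ys ] f x y ≡ ∑[ y ∈ ys ] ∑[ x ∈ xs ] f x y
∑-comm []       ys f = sym (∑-zero ys)
∑-comm (x ∷ xs) ys f = trans (cong (∑ ys (f x) +_) (∑-comm xs ys f)) (sym (∑-+ ys (f x) _))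

∑-cartesianProduct : ∀ (xs : List A) (ys : List B) (f : A × B → ℕ) →
                     ∑ (cartesianProduct xs ys) f ≡ ∑[ x ∈ xs ] ∑[ y ∈ ys ] f (x , y)
∑-cartesianProduct []       ys f = refl
∑-cartesianProduct (x ∷ xs) ys f =
  trans (∑-++ (map (x ,_) ys) _ f)
        (cong₂ _+_ (∑-map (x ,_) ys f) (∑-cartesianProduct xs ys f))

∑-filter : ∀ {P : Pred A ℓ′} (P? : Decidable P) xs (f : A → ℕ) →
           ∑ (filter P? xs) f ≡ ∑[ x ∈ xs ] 𝟙 (P? x) * f x
∑-filter P? []       f = refl
∑-filter P? (x ∷ xs) f with P? x
... | yes _ = cong₂ _+_ (sym (+-identityʳ (f x))) (∑-filter P? xs f)
... | no  _ = ∑-filter P? xs f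

length≡∑1 : ∀ (xs : List A) → length xs ≡ ∑[ x ∈ xs ] 1
length≡∑1 []       = refl
length≡∑1 (x ∷ xs) = cong suc (length≡∑1 xs)

length-filter≡∑𝟙 : ∀ {P : Pred A ℓ′} (P? : Decidable P) xs →
                   length (filter P? xs) ≡ ∑[ x ∈ xs ] 𝟙 (P? x)
length-filter≡∑𝟙 P? []       = refl
length-filter≡∑𝟙 P? (x ∷ xs) with P? x
... | yes _ = cong suc (length-filter≡∑𝟙 P? xs)
... | no  _ = length-filter≡∑𝟙 P? xs

∑-upTo-suc : ∀ n (f : ℕ → ℕ) → ∑ (upTo (suc n)) f ≡ f 0 + (∑[ k ∈ upTo n ] f (suc k))
∑-upTo-suc n f =
  cong (f 0 +_) (trans (cong (λ ks → ∑ ks f) (sym (List.map-upTo suc n))) (∑-map suc (upTo n) f))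

∑-𝟙≟-upTo : ∀ {n} c → c < n → ∑[ k ∈ upTo n ] 𝟙 (c ≟ k) ≡ 1
∑-𝟙≟-upTo {suc n} zero    _         =
  trans (∑-upTo-suc n (λ k → 𝟙 (0 ≟ k))) (cong suc (∑-zero (upTo n)))
∑-𝟙≟-upTo {suc n} (suc c) (s≤s c<n) =
  trans (∑-upTo-suc n (λ k → 𝟙 (suc c ≟ k))) (∑-𝟙≟-upTo c c<n)

∑-length-fibres : ∀ n (f : A → ℕ) xs → (∀ x → f x < n) →
                  ∑[ k ∈ upTo n ] length (filter (λ x → f x ≟ k) xs) ≡ length xs
∑-length-fibres n f xs f<n = begin
  ∑[ k ∈ upTo n ] length (filter (λ x → f x ≟ k) xs)
    ≡⟨ ∑-cong (upTo n) (λ k → length-filter≡∑𝟙 (λ x → f x ≟ k) xs) ⟩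
  ∑[ k ∈ upTo n ] ∑[ x ∈ xs ] 𝟙 (f x ≟ k)  ≡⟨ ∑-comm (upTo n) xs _ ⟩
  ∑[ x ∈ xs ] ∑[ k ∈ upTo n ] 𝟙 (f x ≟ k)  ≡⟨ ∑-cong xs (λ x → ∑-𝟙≟-upTo (f x) (f<n x)) ⟩
  ∑[ x ∈ xs ] 1                            ≡⟨ length≡∑1 xs ⟨
  length xs                                ∎
  where open ≡-Reasoning

_≟ₚ_ : DecidableEquality Point
_≟ₚ_ = ≡-dec _≟_ _≟_

level : Point → ℕ
level (x , y) = x + y

level-step : ∀ a s → level (step a s) ≡ suc (level a)
level-step (x , y) true  = +-suc x y
level-step (x , y) false = refl

data Graded : ℕ → List Point → Set where
  []  : ∀ {s} → Graded s []
  _∷_ : ∀ {s x xs} → level x ≡ s → Graded (suc s) xs → Graded s (x ∷ xs)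

graded-take : ∀ k {s xs} → Graded s xs → Graded s (take k xs)
graded-take zero    _          = []
graded-take (suc k) []         = []
graded-take (suc k) (lx ∷ gxs) = lx ∷ graded-take k gxs

graded-vertsFrom : ∀ {m} a (p : Vec Bool m) → Graded (suc (level a)) (vertsFrom a p)
graded-vertsFrom a []      = []
graded-vertsFrom a (s ∷ p) =
  level-step a s ∷ subst (λ l → Graded (suc l) (vertsFrom (step a s) p))
                         (level-step a s) (graded-vertsFrom (step a s) p)

graded-∈ : ∀ {s xs z} → Graded s xs → z ∈ xs → s ≤ level z
graded-∈ (lx ∷ gxs) (here refl)  = ≤-reflexive (sym lx)
graded-∈ (lx ∷ gxs) (there z∈xs) = <⇒≤ (graded-∈ gxs z∈xs)

coincidences : List Point → List Point → ℕ
coincidences (x ∷ xs) (y ∷ ys) = 𝟙 (x ≟ₚ y) + coincidences xs ys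
coincidences _        _        = 0

∑-∈?-drop : ∀ {t xs} y ys → Graded t xs → level y < t →
            ∑[ x ∈ xs ] 𝟙 (x ∈? y ∷ ys) ≡ ∑[ x ∈ xs ] 𝟙 (x ∈? ys)
∑-∈?-drop y ys []                  y<t = refl
∑-∈?-drop y ys (_∷_ {x = x} lx gxs) y<t =
  cong₂ _+_ (𝟙-⇔ (mk⇔ to there) (x ∈? y ∷ ys) (x ∈? ys)) (∑-∈?-drop y ys gxs (m<n⇒m<1+n y<t))
  where
  to : x ∈ y ∷ ys → x ∈ ys
  to (here refl)  = ⊥-elim (<-irrefl lx y<t)
  to (there x∈ys) = x∈ys

-- In graded lists equal points sit at equal positions.
∑-∈?≡coincidences : ∀ {s xs ys} → Graded s xs → Graded s ys →
                    ∑[ x ∈ xs ] 𝟙 (x ∈? ys) ≡ coincidences xs ys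
∑-∈?≡coincidences []                  _                    = refl
∑-∈?≡coincidences {xs = _ ∷ xs} (_ ∷ _) []                 = ∑-zero xs
∑-∈?≡coincidences {s} {x ∷ xs} {y ∷ ys} (lx ∷ gxs) (ly ∷ gys) =
  cong₂ _+_ (𝟙-⇔ (mk⇔ to here) (x ∈? y ∷ ys) (x ≟ₚ y))
            (trans (∑-∈?-drop y ys gxs (≤-reflexive (cong suc ly))) (∑-∈?≡coincidences gxs gys))
  where
  to : x ∈ y ∷ ys → x ≡ y
  to (here x≡y)   = x≡y
  to (there x∈ys) = ⊥-elim (<-irrefl (sym lx) (graded-∈ gys x∈ys))

commonInterior≡coincidences : ∀ {n} (p q : Path n) →
                              commonInterior p q ≡ coincidences (interior p) (interior q)
commonInterior≡coincidences {n} p q =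
  trans (length-filter≡∑𝟙 (_∈? interior q) (interior p))
        (∑-∈?≡coincidences (graded-take (n ∸ 1) (graded-vertsFrom (0 , 0) p))
                           (graded-take (n ∸ 1) (graded-vertsFrom (0 , 0) q)))

step-comm : ∀ a s t → step (step a s) t ≡ step (step a t) s
step-comm (x , y) true  true  = refl
step-comm (x , y) true  false = refl
step-comm (x , y) false true  = refl
step-comm (x , y) false false = refl

step-injective : ∀ a b s → step a s ≡ step b s → a ≡ b
step-injective (x , y) (.x , .y) true  refl = refl
step-injective (x , y) (.x , .y) false refl = refl

endFrom-step : ∀ {m} a s (p : Vec Bool m) → endFrom (step a s) p ≡ step (endFrom a p) s
endFrom-step a s []      = refl
endFrom-step a s (t ∷ p) =
  trans (cong (λ c → endFrom c p) (step-comm a s t)) (endFrom-step (step a t) s p)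

𝟙-step : ∀ a b s → 𝟙 (step a s ≟ₚ step b s) ≡ 𝟙 (a ≟ₚ b)
𝟙-step a b s =
  𝟙-⇔ (mk⇔ (step-injective a b s) (cong (λ c → step c s))) (step a s ≟ₚ step b s) (a ≟ₚ b)

𝟙-swap : ∀ a b → 𝟙 (b ≟ₚ a) ≡ 𝟙 (a ≟ₚ b)
𝟙-swap a b = 𝟙-⇔ (mk⇔ sym sym) (b ≟ₚ a) (a ≟ₚ b)

endsTogether : ∀ {m} → Point → Point → Vec Bool m → Vec Bool m → ℕ
endsTogether a b p q = 𝟙 (endFrom a p ≟ₚ endFrom b q)

meetings : ∀ {m} → Point → Point → Vec Bool m → Vec Bool m → ℕ
meetings a b p q = coincidences (vertsFrom a p) (vertsFrom b q)

endsTogether-shift : ∀ {m} a b s (p q : Vec Bool m) →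
                     endsTogether (step a s) (step b s) p q ≡ endsTogether a b p q
endsTogether-shift a b s p q rewrite endFrom-step a s p | endFrom-step b s q = 𝟙-step _ _ s

meetings-shift : ∀ {m} a b s (p q : Vec Bool m) → meetings (step a s) (step b s) p q ≡ meetings a b p q
meetings-shift a b s []      []      = refl
meetings-shift a b s (x ∷ p) (y ∷ q) rewrite step-comm a s x | step-comm b s y =
  cong₂ _+_ (𝟙-step (step a x) (step b y) s) (meetings-shift (step a x) (step b y) s p q)

endsTogether-swap : ∀ {m} a b (p q : Vec Bool m) → endsTogether b a q p ≡ endsTogether a b p q
endsTogether-swap a b p q = 𝟙-swap (endFrom a p) (endFrom b q)

meetings-swap : ∀ {m} a b (p q : Vec Bool m) → meetings b a q p ≡ meetings a b p q
meetings-swap a b []      []      = refl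
meetings-swap a b (x ∷ p) (y ∷ q) =
  cong₂ _+_ (𝟙-swap (step a x) (step b y)) (meetings-swap (step a x) (step b y) p q)

meetings≡interior+endsTogether : ∀ {m} a b (p q : Vec Bool (suc m)) →
  meetings a b p q ≡ coincidences (take m (vertsFrom a p)) (take m (vertsFrom b q)) + endsTogether a b p q
meetings≡interior+endsTogether {zero}  a b (x ∷ []) (y ∷ []) = +-identityʳ _
meetings≡interior+endsTogether {suc m} a b (x ∷ p)  (y ∷ q)  =
  trans (cong (𝟙 (step a x ≟ₚ step b y) +_) (meetings≡interior+endsTogether (step a x) (step b y) p q))
        (sym (+-assoc (𝟙 (step a x ≟ₚ step b y)) _ _))

pairSum : (m : ℕ) → (Path m → Path m → ℕ) → ℕ
pairSum m w = ∑[ p ∈ allPaths m ] ∑[ q ∈ allPaths m ] w p q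

pairSum-cong : ∀ m {v w : Path m → Path m → ℕ} → (∀ p q → v p q ≡ w p q) → pairSum m v ≡ pairSum m w
pairSum-cong m v≗w = ∑-cong (allPaths m) (λ p → ∑-cong (allPaths m) (v≗w p))

pairSum-swap : ∀ m (w : Path m → Path m → ℕ) → pairSum m (λ p q → w q p) ≡ pairSum m w
pairSum-swap m w = ∑-comm (allPaths m) (allPaths m) (λ p q → w q p)

pairSum-*0 : ∀ m (w : Path m → Path m → ℕ) → pairSum m (λ p q → w p q * 0) ≡ 0
pairSum-*0 m w =
  trans (pairSum-cong m (λ p q → *-zeroʳ (w p q)))
        (trans (∑-cong (allPaths m) (λ _ → ∑-zero (allPaths m))) (∑-zero (allPaths m)))

∑-allPaths-suc : ∀ m (f : Path (suc m) → ℕ) →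
  ∑ (allPaths (suc m)) f ≡ (∑[ p ∈ allPaths m ] f (true ∷ p)) + (∑[ p ∈ allPaths m ] f (false ∷ p))
∑-allPaths-suc m f =
  trans (∑-++ (map (true ∷_) (allPaths m)) _ f)
        (cong₂ _+_ (∑-map (true ∷_) (allPaths m) f) (∑-map (false ∷_) (allPaths m) f))

pairSum-suc : ∀ m (w : Path (suc m) → Path (suc m) → ℕ) →
  let W = λ s t → pairSum m (λ p q → w (s ∷ p) (t ∷ q)) in
  pairSum (suc m) w ≡ (W true true + W true false) + (W false true + W false false)
pairSum-suc m w =
  trans (∑-allPaths-suc m (λ p → ∑ (allPaths (suc m)) (w p)))
        (cong₂ _+_ (split true) (split false))
  where
  split : ∀ s → ∑[ p ∈ allPaths m ] ∑ (allPaths (suc m)) (w (s ∷ p))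
              ≡ pairSum m (λ p q → w (s ∷ p) (true ∷ q)) + pairSum m (λ p q → w (s ∷ p) (false ∷ q))
  split s = trans (∑-cong (allPaths m) (λ p → ∑-allPaths-suc m (w (s ∷ p)))) (∑-+ (allPaths m) _ _)

ShiftInvariant : (Point → Point → ℕ) → Set
ShiftInvariant N = ∀ a b s → N (step a s) (step b s) ≡ N a b

SwapInvariant : (Point → Point → ℕ) → Set
SwapInvariant N = ∀ a b → N b a ≡ N a b

atDistance : (Point → Point → ℕ) → ℕ → ℕ
atDistance N h = N (0 , h) (h , 0)

firstMoves : (Point → Point → ℕ) → Point → Point → ℕ
firstMoves N a b = (N (step a true) (step b true) + N (step a true) (step b false))
                 + (N (step a false) (step b true) + N (step a false) (step b false))

afterOneStep : (ℕ → ℕ) → ℕ → ℕ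
afterOneStep f zero    = (f 0 + f 1) + (f 1 + f 0)
afterOneStep f (suc h) = (f (suc h) + f (suc (suc h))) + (f h + f (suc h))

afterOneStep-cong : ∀ {f g} → (∀ h → f h ≡ g h) → ∀ h → afterOneStep f h ≡ afterOneStep g h
afterOneStep-cong f≗g zero    = cong₂ _+_ (cong₂ _+_ (f≗g 0) (f≗g 1)) (cong₂ _+_ (f≗g 1) (f≗g 0))
afterOneStep-cong f≗g (suc h) =
  cong₂ _+_ (cong₂ _+_ (f≗g (suc h)) (f≗g (suc (suc h)))) (cong₂ _+_ (f≗g h) (f≗g (suc h)))

-- The four successors of ((0 , h) , (h , 0)) are again of this form after undoing
-- a common step and possibly swapping the walkers.
firstMoves-atDistance : ∀ {N} → ShiftInvariant N → SwapInvariant N →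
                        ∀ h → firstMoves N (0 , h) (h , 0) ≡ afterOneStep (atDistance N) h
firstMoves-atDistance shift swap zero =
  cong₂ _+_ (cong₂ _+_ (shift (0 , 0) (0 , 0) true) refl)
            (cong₂ _+_ (swap (0 , 1) (1 , 0)) (shift (0 , 0) (0 , 0) false))
firstMoves-atDistance shift swap (suc h) =
  cong₂ _+_ (cong₂ _+_ (shift (0 , suc h) (suc h , 0) true) refl)
            (cong₂ _+_ (trans (shift (0 , suc h) (h , 1) false) (shift (0 , h) (h , 0) true))
                       (shift (0 , suc h) (suc h , 0) false))

joiningPairs : ℕ → Point → Point → ℕ
joiningPairs m a b = pairSum m (endsTogether a b)

meetingPairs : ℕ → ℕ → Point → Point → ℕ
meetingPairs m j a b = pairSum m (λ p q → endsTogether a b p q * 𝟙 (meetings a b p q ≟ j))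

-- The start counts as a meeting too: the continuations of a step that led to a and b.
arrivingPairs : ℕ → ℕ → Point → Point → ℕ
arrivingPairs m j a b = pairSum m (λ p q → endsTogether a b p q * 𝟙 (𝟙 (a ≟ₚ b) + meetings a b p q ≟ j))

joiningPairs-shift : ∀ m → ShiftInvariant (joiningPairs m)
joiningPairs-shift m a b s = pairSum-cong m (endsTogether-shift a b s)

joiningPairs-swap : ∀ m → SwapInvariant (joiningPairs m)
joiningPairs-swap m a b =
  trans (pairSum-cong m (λ p q → endsTogether-swap a b q p)) (pairSum-swap m (endsTogether a b))

arrivingPairs-shift : ∀ m j → ShiftInvariant (arrivingPairs m j)
arrivingPairs-shift m j a b s = pairSum-cong m λ p q →
  cong₂ (λ e c → e * 𝟙 (c ≟ j)) (endsTogether-shift a b s p q)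
        (cong₂ _+_ (𝟙-step a b s) (meetings-shift a b s p q))

arrivingPairs-swap : ∀ m j → SwapInvariant (arrivingPairs m j)
arrivingPairs-swap m j a b =
  trans (pairSum-cong m λ p q →
           cong₂ (λ e c → e * 𝟙 (c ≟ j)) (endsTogether-swap a b q p)
                 (cong₂ _+_ (𝟙-swap a b) (meetings-swap a b q p)))
        (pairSum-swap m (λ p q → endsTogether a b p q * 𝟙 (𝟙 (a ≟ₚ b) + meetings a b p q ≟ j)))

joiningPairs-suc : ∀ m h →
  atDistance (joiningPairs (suc m)) h ≡ afterOneStep (atDistance (joiningPairs m)) h
joiningPairs-suc m h =
  trans (pairSum-suc m (endsTogether (0 , h) (h , 0)))
        (firstMoves-atDistance (joiningPairs-shift m) (joiningPairs-swap m) h)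

meetingPairs-suc : ∀ m j h →
  atDistance (meetingPairs (suc m) j) h ≡ afterOneStep (atDistance (arrivingPairs m j)) h
meetingPairs-suc m j h =
  trans (pairSum-suc m (λ p q → endsTogether (0 , h) (h , 0) p q * 𝟙 (meetings (0 , h) (h , 0) p q ≟ j)))
        (firstMoves-atDistance (arrivingPairs-shift m j) (arrivingPairs-swap m j) h)

pascal² : ∀ n k → (n C k + n C suc k) + (n C suc k + n C suc (suc k)) ≡ suc (suc n) C suc (suc k)
pascal² n k = trans (cong₂ _+_ (nCk+nC[k+1]≡[n+1]C[k+1] n k) (nCk+nC[k+1]≡[n+1]C[k+1] n (suc k)))
                    (nCk+nC[k+1]≡[n+1]C[k+1] (suc n) (suc k))

pascal²-middle : ∀ m → let n = m + m in
  (n C m + n C suc m) + (n C suc m + n C m) ≡ suc (suc n) C suc m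
pascal²-middle m = begin
  (n C m + n C suc m) + (n C suc m + n C m) ≡⟨ cong ((n C m + n C suc m) +_) (+-comm (n C suc m) (n C m)) ⟩
  (n C m + n C suc m) + (n C m + n C suc m) ≡⟨ cong₂ _+_ pascal pascal ⟩
  suc n C suc m + suc n C suc m             ≡⟨ cong (_+ suc n C suc m) middle-sym ⟨
  suc n C m + suc n C suc m                 ≡⟨ nCk+nC[k+1]≡[n+1]C[k+1] (suc n) m ⟩
  suc (suc n) C suc m                       ∎
  where
  open ≡-Reasoning
  n : ℕ
  n = m + m
  pascal : n C m + n C suc m ≡ suc n C suc m
  pascal = nCk+nC[k+1]≡[n+1]C[k+1] n m
  middle-sym : suc n C m ≡ suc n C suc m
  middle-sym = trans (nCk≡nC[n∸k] (m≤n⇒m≤1+n (m≤m+n m m)))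
                     (cong (suc n C_) (trans (cong (_∸ m) (sym (+-suc m m))) (m+n∸m≡n m (suc m))))

afterOneStep-binomial : ∀ m h → afterOneStep (λ h′ → (m + m) C (m + h′)) h ≡ (suc m + suc m) C (suc m + h)
afterOneStep-binomial m zero    rewrite +-identityʳ m | +-comm m 1 | +-suc m m = pascal²-middle m
afterOneStep-binomial m (suc h) rewrite +-suc m (suc h) | +-suc m h | +-suc m m =
  trans (+-comm (X 1 + X 2) (X 0 + X 1)) (pascal² (m + m) (m + h))
  where
  X : ℕ → ℕ
  X i = (m + m) C (i + (m + h))

binomial-factorials : ∀ {n k} → k ≤ n → (n C k) * (k ! * (n ∸ k) !) ≡ n !
binomial-factorials {n} {k} k≤n = begin
  (n C k) * (k ! * (n ∸ k) !)                 ≡⟨ cong (_* (k ! * (n ∸ k) !)) (nCk≡n!/k![n-k]! k≤n) ⟩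
  n ! / (k ! * (n ∸ k) !) * (k ! * (n ∸ k) !)   ≡⟨ *-comm _ (k ! * (n ∸ k) !) ⟩
  (k ! * (n ∸ k) !) * (n ! / (k ! * (n ∸ k) !)) ≡⟨ m*[n/m]≡n (k![n∸k]!∣n! k≤n) ⟩
  n !                                          ∎
  where
  open ≡-Reasoning
  instance _ = k !* (n ∸ k) !≢0

central-binomial-factorials : ∀ n → ((n + n) C n) * (n ! * n !) ≡ (n + n) !
central-binomial-factorials n =
  subst (λ r → ((n + n) C n) * (n ! * r !) ≡ (n + n) !) (m+n∸m≡n n n) (binomial-factorials (m≤m+n n n))

*≡!⇒0< : ∀ {m k} n → m * k ≡ n ! → 0 < m
*≡!⇒0< {zero}  n 0≡n! = ⊥-elim (<-irrefl 0≡n! (1≤n! n))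
*≡!⇒0< {suc m} n _    = z<s

central-binomial-positive : ∀ n → 0 < (n + n) C n
central-binomial-positive n = *≡!⇒0< (n + n) (central-binomial-factorials n)

joiningPairs-closed : ∀ m h → atDistance (joiningPairs m) h ≡ (m + m) C (m + h)
joiningPairs-closed zero    zero    = refl
joiningPairs-closed zero    (suc h) = refl
joiningPairs-closed (suc m) h =
  trans (joiningPairs-suc m h)
        (trans (afterOneStep-cong (joiningPairs-closed m) h) (afterOneStep-binomial m h))

-- ballot a u counts the ±1 walks from height a that first reach 0 after a + 2u steps.
ballot : ℕ → ℕ → ℕ
ballot zero    zero    = 1
ballot zero    (suc u) = 0
ballot (suc a) zero    = 1
ballot (suc a) (suc u) = ballot a (suc u) + ballot (suc (suc a)) u

truncBallot : ℕ → ℕ → ℕ → ℕ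
truncBallot a m       zero    = ballot a m
truncBallot a zero    (suc c) = 0
truncBallot a (suc m) (suc c) = truncBallot a m c

truncBallot-+ : ∀ a c u → truncBallot a (c + u) c ≡ ballot a u
truncBallot-+ a zero    u = refl
truncBallot-+ a (suc c) u = truncBallot-+ a c u

truncBallot-suc : ∀ a m c → truncBallot (suc a) m c ≡ truncBallot a m c + truncBallot (suc (suc a)) m (suc c)
truncBallot-suc zero    zero    zero    = refl
truncBallot-suc (suc a) zero    zero    = refl
truncBallot-suc a       (suc m) zero    = refl
truncBallot-suc a       zero    (suc c) = refl
truncBallot-suc a       (suc m) (suc c) = truncBallot-suc a m c

truncBallot-suc² : ∀ a m c →
  truncBallot (2 + a) m c ≡ (truncBallot a m c + truncBallot (2 + a) m (1 + c))
                          + (truncBallot (2 + a) m (1 + c) + truncBallot (4 + a) m (2 + c))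
truncBallot-suc² a m c =
  trans (truncBallot-suc (suc a) m c)
        (cong₂ _+_ (truncBallot-suc a m c) (truncBallot-suc (2 + a) m (suc c)))

ballot-closed : ∀ b u → ballot (suc b) u * (u ! * (suc b + u) !) ≡ suc b * (b + (u + u)) !
ballot-closed b zero = base b ((b + 0) !)
  where base : ∀ b X → 1 * (1 * (suc (b + 0) * X)) ≡ suc b * X
        base = solve-∀
ballot-closed zero (suc u) = begin
  ballot 2 u * (suc u * u ! * (2 + u) !)   ≡⟨ regroup u (ballot 2 u) (u !) ((2 + u) !) ⟩
  suc u * (ballot 2 u * (u ! * (2 + u) !)) ≡⟨ cong (suc u *_) (ballot-closed 1 u) ⟩
  suc u * (2 * suc (u + u) !)             ≡⟨ double u (suc (u + u) !) ⟩
  suc (suc (u + u)) * suc (u + u) !       ≡⟨ cong (λ n → suc n !) (+-suc u u) ⟨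
  (suc u + suc u) !                        ≡⟨ *-identityˡ _ ⟨
  1 * (suc u + suc u) !                    ∎
  where
  open ≡-Reasoning
  regroup : ∀ u B U Y → B * (suc u * U * Y) ≡ suc u * (B * (U * Y))
  regroup = solve-∀
  double : ∀ u Z → suc u * (2 * Z) ≡ suc (suc (u + u)) * Z
  double = solve-∀
ballot-closed (suc b) (suc u) = begin
  (F₁ + F₂) * (suc u * U * (suc (suc b) + suc u) !)
    ≡⟨ cong (λ n → (F₁ + F₂) * (suc u * U * n !)) (+-suc (suc (suc b)) u) ⟩
  (F₁ + F₂) * (suc u * U * (L * Y))
    ≡⟨ distribute b u F₁ F₂ U Y ⟩
  L * (F₁ * (suc u * U * Y)) + suc u * (F₂ * (U * (L * Y)))
    ≡⟨ cong₂ (λ x y → L * x + suc u * y)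
             (reindex (ballot-closed b (suc u))) (ballot-closed (suc (suc b)) u) ⟩
  L * (suc b * Z) + suc u * (suc (suc (suc b)) * Z)
    ≡⟨ collect b u Z ⟩
  suc (suc b) * (suc (suc (suc (b + (u + u)))) * Z)
    ≡⟨ cong (λ n → suc (suc b) * suc n !) (index b u) ⟨
  suc (suc b) * (suc b + (suc u + suc u)) ! ∎
  where
  open ≡-Reasoning
  F₁ F₂ U L Y Z : ℕ
  F₁ = ballot (suc b) (suc u)
  F₂ = ballot (suc (suc (suc b))) u
  U = u !
  L = suc (suc (suc (b + u)))
  Y = (suc (suc b) + u) !
  Z = (suc (suc b) + (u + u)) !
  index : ∀ b u → b + (suc u + suc u) ≡ suc (suc (b + (u + u)))
  index = solve-∀
  reindex : F₁ * (suc u * U * (suc b + suc u) !) ≡ suc b * (b + (suc u + suc u)) ! →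
            F₁ * (suc u * U * Y) ≡ suc b * Z
  reindex = subst₂ (λ y z → F₁ * (suc u * U * y !) ≡ suc b * z !) (cong suc (+-suc b u)) (index b u)
  distribute : ∀ b u F₁ F₂ U Y → let L = suc (suc (suc (b + u))) in
    (F₁ + F₂) * (suc u * U * (L * Y)) ≡ L * (F₁ * (suc u * U * Y)) + suc u * (F₂ * (U * (L * Y)))
  distribute = solve-∀
  collect : ∀ b u Z → let L = suc (suc (suc (b + u))) in
    L * (suc b * Z) + suc u * (suc (suc (suc b)) * Z) ≡ suc (suc b) * (suc (suc (suc (b + (u + u)))) * Z)
  collect = solve-∀

meetingsClosed : ℕ → ℕ → ℕ → ℕ
arrivalsClosed : ℕ → ℕ → ℕ → ℕ

meetingsClosed m zero    j = 2 ^ j * truncBallot j m j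
meetingsClosed m (suc h) j = arrivalsClosed m (suc h) j

arrivalsClosed m h zero    = 0
arrivalsClosed m h (suc j) = 2 ^ j * truncBallot (h * 2 + j) m (h + j)

meetingsClosed-suc : ∀ m h j → meetingsClosed (suc m) h j ≡ afterOneStep (λ h′ → arrivalsClosed m h′ j) h
meetingsClosed-suc m zero    zero    = refl
meetingsClosed-suc m (suc h) zero    = refl
meetingsClosed-suc m zero    (suc j) =
  trans (cong (2 * 2 ^ j *_) (truncBallot-suc j m j))
        (spread (2 ^ j) (truncBallot j m j) (truncBallot (2 + j) m (1 + j)))
  where spread : ∀ P X Y → 2 * P * (X + Y) ≡ (P * X + P * Y) + (P * Y + P * X)
        spread = solve-∀
meetingsClosed-suc m (suc h) (suc j) =
  trans (cong (2 ^ j *_) (truncBallot-suc² (h * 2 + j) m (h + j)))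
        (spread (2 ^ j) (truncBallot (h * 2 + j) m (h + j)) (truncBallot (2 + (h * 2 + j)) m (1 + (h + j)))
                (truncBallot (4 + (h * 2 + j)) m (2 + (h + j))))
  where spread : ∀ P X Y Z → P * ((X + Y) + (Y + Z)) ≡ (P * Y + P * Z) + (P * X + P * Y)
        spread = solve-∀

meetingPairs-zero : ∀ h j → atDistance (meetingPairs 0 j) h ≡ meetingsClosed 0 h j
meetingPairs-zero zero    zero    = refl
meetingPairs-zero zero    (suc j) = sym (*-zeroʳ (2 ^ suc j))
meetingPairs-zero (suc h) zero    = refl
meetingPairs-zero (suc h) (suc j) = sym (*-zeroʳ (2 ^ j))

meetingPairs-closed : ∀ m h j → atDistance (meetingPairs m j) h ≡ meetingsClosed m h j
arrivingPairs-closed : ∀ m h j → atDistance (arrivingPairs m j) h ≡ arrivalsClosed m h j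

meetingPairs-closed zero    h j = meetingPairs-zero h j
meetingPairs-closed (suc m) h j = begin
  atDistance (meetingPairs (suc m) j) h
    ≡⟨ meetingPairs-suc m j h ⟩
  afterOneStep (atDistance (arrivingPairs m j)) h
    ≡⟨ afterOneStep-cong (λ h′ → arrivingPairs-closed m h′ j) h ⟩
  afterOneStep (λ h′ → arrivalsClosed m h′ j) h
    ≡⟨ meetingsClosed-suc m h j ⟨
  meetingsClosed (suc m) h j
    ∎
  where open ≡-Reasoning

arrivingPairs-closed m zero    zero    = pairSum-*0 m (endsTogether (0 , 0) (0 , 0))
arrivingPairs-closed m zero    (suc j) = meetingPairs-closed m zero j
arrivingPairs-closed m (suc h) j       = meetingPairs-closed m (suc h) j

frac-cross : ∀ a b c d → 0 < b → 0 < d → a * d ≡ c * b → frac a b ≡ frac c d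
frac-cross a (suc b) c (suc d) _ _ ad≡cb = fromℚᵘ-cong {mkℚᵘ (ℤ.+ a) b} {mkℚᵘ (ℤ.+ c) d} (*≡* (begin
  (ℤ.+ a) ℤ.* (ℤ.+ suc d)  ≡⟨ ℤ.pos-* a (suc d) ⟨
  ℤ.+ (a * suc d)          ≡⟨ cong ℤ.+_ ad≡cb ⟩
  ℤ.+ (c * suc b)          ≡⟨ ℤ.pos-* c (suc b) ⟩
  (ℤ.+ c) ℤ.* (ℤ.+ suc b)  ∎))
  where open ≡-Reasoning

frac-self : ∀ n → 0 < n → frac n n ≡ 1ℚ
frac-self n 0<n = frac-cross n n 1 1 0<n z<s (trans (*-identityʳ n) (sym (*-identityˡ n)))

frac-+ : ∀ a b t → frac a (suc t) ℚ.+ frac b (suc t) ≡ frac (a + b) (suc t)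
frac-+ a b t = toℚᵘ-injective (begin
  toℚᵘ (frac a (suc t) ℚ.+ frac b (suc t))
    ≈⟨ toℚᵘ-homo-+ (frac a (suc t)) (frac b (suc t)) ⟩
  toℚᵘ (frac a (suc t)) ℚᵘ.+ toℚᵘ (frac b (suc t))
    ≈⟨ ℚᵘ.+-cong (toℚᵘ-fromℚᵘ (a /suc t)) (toℚᵘ-fromℚᵘ (b /suc t)) ⟩
  a /suc t ℚᵘ.+ b /suc t
    ≈⟨ same-denominator ⟩
  (a + b) /suc t
    ≈⟨ toℚᵘ-fromℚᵘ ((a + b) /suc t) ⟨
  toℚᵘ (frac (a + b) (suc t))
    ∎)
  where
  open ℚᵘ.≃-Reasoning
  _/suc_ : ℕ → ℕ → ℚᵘ
  n /suc d = mkℚᵘ (ℤ.+ n) d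
  distrib : ∀ x y d → (x ℤ.* d ℤ.+ y ℤ.* d) ℤ.* d ≡ (x ℤ.+ y) ℤ.* (d ℤ.* d)
  distrib = ℤ-Solver.solve-∀
  same-denominator : a /suc t ℚᵘ.+ b /suc t ≃ (a + b) /suc t
  same-denominator = *≡* (trans (distrib (ℤ.+ a) (ℤ.+ b) (ℤ.+ suc t))
                                (sym (cong₂ ℤ._*_ (ℤ.pos-+ a b) (ℤ.pos-* (suc t) (suc t)))))

∑ℚ : List ℕ → (ℕ → ℚ) → ℚ
∑ℚ ks f = foldr (λ k acc → f k ℚ.+ acc) 0ℚ ks

∑ℚ-cong : ∀ {f g} ks → All (λ k → f k ≡ g k) ks → ∑ℚ ks f ≡ ∑ℚ ks g
∑ℚ-cong []       []             = refl
∑ℚ-cong (k ∷ ks) (fk≡gk ∷ f≗g) = cong₂ ℚ._+_ fk≡gk (∑ℚ-cong ks f≗g)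

∑ℚ-frac : ∀ ks (f : ℕ → ℕ) n → 0 < n → ∑ℚ ks (λ k → frac (f k) n) ≡ frac (∑ ks f) n
∑ℚ-frac []       f (suc t) _   = sym (0/n≡0 (suc t))
∑ℚ-frac (k ∷ ks) f (suc t) 0<n =
  trans (cong (frac (f k) (suc t) ℚ.+_) (∑ℚ-frac ks f (suc t) 0<n)) (frac-+ (f k) (∑ ks f) t)

sameEndPairs-length : ∀ n → length (sameEndPairs n) ≡ (n + n) C n
sameEndPairs-length n = begin
  length (sameEndPairs n)
    ≡⟨ length-filter≡∑𝟙 sameEnd? (cartesianProduct P P) ⟩
  ∑[ pq ∈ cartesianProduct P P ] 𝟙 (sameEnd? pq)
    ≡⟨ ∑-cartesianProduct P P (λ pq → 𝟙 (sameEnd? pq)) ⟩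
  atDistance (joiningPairs n) 0
    ≡⟨ joiningPairs-closed n 0 ⟩
  (n + n) C (n + 0)
    ≡⟨ cong ((n + n) C_) (+-identityʳ n) ⟩
  (n + n) C n ∎
  where
  open ≡-Reasoning
  P : List (Path n)
  P = allPaths n

sameEndPairs-positive : ∀ n → 0 < length (sameEndPairs n)
sameEndPairs-positive n = subst (0 <_) (sym (sameEndPairs-length n)) (central-binomial-positive n)

𝟙*𝟙≟-shift : ∀ (A? : Dec A) c k → 𝟙 A? * 𝟙 (c ≟ k) ≡ 𝟙 A? * 𝟙 (c + 𝟙 A? ≟ suc k)
𝟙*𝟙≟-shift A? c k with does A?
... | true  rewrite +-comm c 1 = refl
... | false = refl

sameEnd-commonInterior : ∀ {m} k (p q : Path (suc m)) →
  endsTogether (0 , 0) (0 , 0) p q * 𝟙 (commonInterior p q ≟ k)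
    ≡ endsTogether (0 , 0) (0 , 0) p q * 𝟙 (meetings (0 , 0) (0 , 0) p q ≟ suc k)
sameEnd-commonInterior k p q
  rewrite commonInterior≡coincidences p q | meetings≡interior+endsTogether (0 , 0) (0 , 0) p q =
  𝟙*𝟙≟-shift (endpoint p ≟ₚ endpoint q) (coincidences (interior p) (interior q)) k

countK-length : ∀ m k → length (countK (suc m) k) ≡ atDistance (meetingPairs (suc m) (suc k)) 0
countK-length m k = begin
  length (filter ci≟k (filter sameEnd? (cartesianProduct P P)))
    ≡⟨ length-filter≡∑𝟙 ci≟k (filter sameEnd? (cartesianProduct P P)) ⟩
  ∑[ pq ∈ filter sameEnd? (cartesianProduct P P) ] 𝟙 (ci≟k pq)
    ≡⟨ ∑-filter sameEnd? (cartesianProduct P P) (λ pq → 𝟙 (ci≟k pq)) ⟩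
  ∑[ pq ∈ cartesianProduct P P ] 𝟙 (sameEnd? pq) * 𝟙 (ci≟k pq)
    ≡⟨ ∑-cartesianProduct P P (λ pq → 𝟙 (sameEnd? pq) * 𝟙 (ci≟k pq)) ⟩
  pairSum (suc m) (λ p q → endsTogether (0 , 0) (0 , 0) p q * 𝟙 (commonInterior p q ≟ k))
    ≡⟨ pairSum-cong (suc m) (sameEnd-commonInterior k) ⟩
  atDistance (meetingPairs (suc m) (suc k)) 0
    ∎
  where
  open ≡-Reasoning
  P : List (Path (suc m))
  P = allPaths (suc m)
  ci≟k : Decidable (λ (pq : Path (suc m) × Path (suc m)) → commonInterior (proj₁ pq) (proj₂ pq) ≡ k)
  ci≟k pq = commonInterior (proj₁ pq) (proj₂ pq) ≟ k

countK-closed : ∀ k u → length (countK (suc (k + u)) k) ≡ 2 ^ suc k * ballot (suc k) u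
countK-closed k u =
  trans (countK-length (k + u) k)
        (trans (meetingPairs-closed (suc (k + u)) 0 (suc k))
               (cong (2 ^ suc k *_) (truncBallot-+ (suc k) k u)))

commonInterior< : ∀ {m} (p q : Path (suc m)) → commonInterior p q < suc m
commonInterior< {m} p q = s≤s (begin
  commonInterior p q       ≤⟨ List.length-filter (_∈? interior q) (interior p) ⟩
  length (interior p)      ≡⟨ List.length-take m (verts p) ⟩
  m ⊓ length (verts p)     ≤⟨ m⊓n≤m m _ ⟩
  m                        ∎)
  where open ≤-Reasoning

∑condProb≡1 : ∀ m → sumBelow (suc m) (condProb (suc m)) ≡ 1ℚ
∑condProb≡1 m = begin
  sumBelow n (condProb n)
    ≡⟨ ∑ℚ-frac (upTo n) (λ k → length (countK n k)) T T>0 ⟩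
  frac (∑[ k ∈ upTo n ] length (countK n k)) T
    ≡⟨ cong (λ x → frac x T) (∑-length-fibres n (λ pq → commonInterior (proj₁ pq) (proj₂ pq))
                                               (sameEndPairs n) (λ pq → commonInterior< (proj₁ pq) (proj₂ pq))) ⟩
  frac T T
    ≡⟨ frac-self T T>0 ⟩
  1ℚ ∎
  where
  open ≡-Reasoning
  n T : ℕ
  n = suc m
  T = length (sameEndPairs n)
  T>0 : 0 < T
  T>0 = sameEndPairs-positive n

pClosed-simplified : ∀ k u → let n = suc (k + u) in
  pClosed n k ≡ frac (2 ^ suc k * suc k * (k + (u + u)) ! * n !) (u ! * (n + n) !)
pClosed-simplified k u = cong₂ frac
  (cong₂ (λ s r → 2 ^ s * s * r ! * n !) (+-comm k 1) 2n∸k∸2≡k+2u)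
  (cong₂ (λ r s → r ! * s !) (n∸k∸1≡u k) (cong (n +_) (+-identityʳ n)))
  where
  n : ℕ
  n = suc (k + u)
  2n≡k+2+k+2u : ∀ k u → 2 * suc (k + u) ≡ k + (2 + (k + (u + u)))
  2n≡k+2+k+2u = solve-∀
  2n∸k∸2≡k+2u : 2 * n ∸ k ∸ 2 ≡ k + (u + u)
  2n∸k∸2≡k+2u = trans (cong (λ r → r ∸ k ∸ 2) (2n≡k+2+k+2u k u))
                      (cong (_∸ 2) (m+n∸m≡n k (2 + (k + (u + u)))))
  n∸k∸1≡u : ∀ k → suc (k + u) ∸ k ∸ 1 ≡ u
  n∸k∸1≡u zero    = refl
  n∸k∸1≡u (suc k) = n∸k∸1≡u k

condProb-closed : ∀ k u → condProb (suc (k + u)) k ≡ pClosed (suc (k + u)) k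
condProb-closed k u = begin
  condProb n k                  ≡⟨ cong₂ frac (countK-closed k u) (sameEndPairs-length n) ⟩
  frac (2 ^ suc k * F) ((n + n) C n)
    ≡⟨ frac-cross _ _ _ _ (central-binomial-positive n) (*-mono-≤ (1≤n! u) (1≤n! (n + n))) cross ⟩
  frac (2 ^ suc k * suc k * (k + (u + u)) ! * n !) (u ! * (n + n) !)
    ≡⟨ pClosed-simplified k u ⟨
  pClosed n k                   ∎
  where
  open ≡-Reasoning
  n F : ℕ
  n = suc (k + u)
  F = ballot (suc k) u
  regroup : ∀ P B U C N → P * B * (U * (C * (N * N))) ≡ P * (B * (U * N)) * N * C
  regroup = solve-∀
  reassoc : ∀ P s W N C → P * (s * W) * N * C ≡ P * s * W * N * C
  reassoc = solve-∀
  cross : 2 ^ suc k * F * (u ! * (n + n) !) ≡ 2 ^ suc k * suc k * (k + (u + u)) ! * n ! * ((n + n) C n)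
  cross = begin
    2 ^ suc k * F * (u ! * (n + n) !)
      ≡⟨ cong (λ x → 2 ^ suc k * F * (u ! * x)) (central-binomial-factorials n) ⟨
    2 ^ suc k * F * (u ! * (((n + n) C n) * (n ! * n !)))
      ≡⟨ regroup (2 ^ suc k) F (u !) ((n + n) C n) (n !) ⟩
    2 ^ suc k * (F * (u ! * n !)) * n ! * ((n + n) C n)
      ≡⟨ cong (λ x → 2 ^ suc k * x * n ! * ((n + n) C n)) (ballot-closed k u) ⟩
    2 ^ suc k * (suc k * (k + (u + u)) !) * n ! * ((n + n) C n)
      ≡⟨ reassoc (2 ^ suc k) (suc k) ((k + (u + u)) !) (n !) ((n + n) C n) ⟩
    2 ^ suc k * suc k * (k + (u + u)) ! * n ! * ((n + n) C n) ∎

condProb≡pClosed : ∀ n k → k < n → condProb n k ≡ pClosed n k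
condProb≡pClosed n k k<n with m≤n⇒∃[o]m+o≡n k<n
... | u , refl = condProb-closed k u

mainTheorem5 : (n : ℕ) → 1 ≤ n →
    ((k : ℕ) → k < n → condProb n k ≡ pClosed n k) × (sumBelow n (pClosed n) ≡ 1ℚ)
mainTheorem5 n@(suc m) _ = condProb≡pClosed n , (begin
  sumBelow n (pClosed n)
    ≡⟨ ∑ℚ-cong (upTo n) (applyUpTo⁺₁ id n (λ k<n → sym (condProb≡pClosed n _ k<n))) ⟩
  sumBelow n (condProb n)
    ≡⟨ ∑condProb≡1 m ⟩
  1ℚ ∎)
  where open ≡-Reasoning
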